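{- Let $W$ be a right-angled Coxeter group and $u,v\in W$. Then $T_L(u\wedge_R v)=T_L(u)\cap T_L(v)$.
   Context: A Coxeter group $W$ with simple generators $S$ and Coxeter matrix $(m_{ij})$ is right-angled if all $m_{ij}\in\{1,2,\infty\}$. The reflections $T$ are the conjugates of elements of $S$; $\ell$ is the length function with respect to $S$. The left inversion set of $w$ is $T_L(w)=\{t\in T:\ell(tw)<\ell(w)\}$. The right weak order $\le_R$ on $W$ is generated by the covers $w\lessdot_R ws$ for $s\in S$ with $\ell(ws)=\ell(w)+1$; it is a meet-semilattice and $\wedge_R$ denotes its meet. -}

module Defs where

open import Data.Nat using (ℕ; zero; suc; _<_; _≤_)
open import Data.Fin using (Fin)
open import Data.Maybe using (Maybe; just; nothing)
open import Data.List using (List; []; _∷_; _++_; length; reverse; [_])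
open import Data.Product using (Σ; _×_; _,_)
open import Data.Sum using (_⊎_)
open import Relation.Binary.PropositionalEquality using (_≡_; _≢_)
open import Relation.Binary.Construct.Closure.Equivalence using (EqClosure)
open import Relation.Binary.Construct.Closure.ReflexiveTransitive using (Star)

-- Coxeter matrix of rank n on generators S = Fin n.
-- Entry (just k) means m_ij = k, entry nothing means m_ij = ∞.
record CoxeterMatrix (n : ℕ) : Set where
  field
    m       : Fin n → Fin n → Maybe ℕ
    sym     : ∀ i j → m i j ≡ m j i
    diag    : ∀ i → m i i ≡ just 1
    offdiag : ∀ i j → i ≢ j → ∀ k → m i j ≡ just k → 2 ≤ k

RightAngled : ∀ {n} → CoxeterMatrix n → Set
RightAngled M = ∀ i j → (m i j ≡ just 1) ⊎ ((m i j ≡ just 2) ⊎ (m i j ≡ nothing))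
  where open CoxeterMatrix M

-- The Coxeter group W = ⟨ S | s² = 1, (st)^{m_st} = 1 ⟩, presented as words
-- in S (every generator is an involution) modulo the congruence generated by
-- s s = ε and the braid relations s t s … = t s t … (m_st factors, m_st < ∞).
module Coxeter {n : ℕ} (M : CoxeterMatrix n) where
  open CoxeterMatrix M

  Word : Set
  Word = List (Fin n)

  alt : Fin n → Fin n → ℕ → Word
  alt s t zero    = []
  alt s t (suc k) = s ∷ alt t s k

  data Rel : Word → Word → Set where
    cancel : ∀ x y s → Rel (x ++ (s ∷ s ∷ y)) (x ++ y)
    braid  : ∀ x y i j k → i ≢ j → m i j ≡ just k →
             Rel (x ++ (alt i j k ++ y)) (x ++ (alt j i k ++ y))

  _≈_ : Word → Word → Set
  _≈_ = EqClosure Rel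

  HasLength : Word → ℕ → Set
  HasLength w k = Σ Word (λ x → (x ≈ w) × (length x ≡ k))
                × (∀ y → y ≈ w → k ≤ length y)

  -- ℓ(x) < ℓ(y)  (unfolding ℓ as a minimum over representing words)
  _ℓ<_ : Word → Word → Set
  x ℓ< y = Σ Word (λ x' → (x' ≈ x) × (∀ y' → y' ≈ y → length x' < length y'))

  Cover : Word → Word → Set
  Cover x y = Σ (Fin n) (λ s → (y ≈ (x ++ [ s ]))
              × Σ ℕ (λ k → HasLength x k × HasLength (x ++ [ s ]) (suc k)))

  _≤R_ : Word → Word → Set
  x ≤R y = Σ Word (λ z → Star Cover x z × (z ≈ y))

  IsMeet : Word → Word → Word → Set
  IsMeet w u v = (w ≤R u) × (w ≤R v) × (∀ z → z ≤R u → z ≤R v → z ≤R w)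

  -- reflections: conjugates w s w⁻¹ (w⁻¹ is the reversed word)
  IsReflection : Word → Set
  IsReflection t = Σ Word (λ w → Σ (Fin n) (λ s → t ≈ (w ++ (s ∷ reverse w))))

  TL : Word → Word → Set
  TL w t = IsReflection t × ((t ++ w) ℓ< w)

module Submission where

-- Normal forms: a word is reduced when no letter can meet an equal letter further right
-- through letters commuting with it, and pushing the letters of any word one at a time
-- onto a reduced word computes a reduced representative.  Two reduced words represent the
-- same element iff their restrictions π a b to all non-commuting pairs {a, b} agree.
--
-- Inversions: the parity of the occurrences of t among the reflections s₁, s₁s₂s₁, … of a
-- word is invariant under the relations; comparing u with t·u shows that a left inversion
-- t of u is such a reflection a s a⁻¹ for a splitting a s b of the reduced word of u.
-- Moving the letters of a that commute with everything to their right past s leaves a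
-- prefix p s of u with t = p s p⁻¹ for which p s p⁻¹ is itself reduced; as the restrictions
-- of p s p⁻¹ are palindromes with a centre of length at most one, this root p s depends on
-- t only.  So for t ∈ T_L(u) ∩ T_L(v) the root lies below u and v, hence below u ∧_R v, and
-- t ∈ T_L(root) ⊆ T_L(u ∧_R v); the other inclusion is monotonicity of T_L in ≤_R.

open import Defs
open import Data.Nat using (ℕ; zero; suc; _+_; _≤_; _<_; z≤n; s≤s) renaming (_≟_ to _≟ℕ_)
open import Data.Nat.Properties
  using ( ≤-refl; ≤-trans; ≤-antisym; ≤-reflexive; <-asym; n<1+n; m≤n⇒m≤1+n; n≤1+n; 1+n≰n
        ; +-suc; +-comm; +-assoc; +-identityʳ; +-monoˡ-≤; +-monoʳ-≤; +-cancelʳ-≤; suc-injective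
        ; module ≤-Reasoning )
open import Data.Fin using (Fin) renaming (_≟_ to _≟F_)
open import Data.Fin.Properties using (all?)
open import Data.Maybe using (just)
open import Data.Maybe.Properties using (just-injective)
import Data.Maybe.Properties as Maybe
import Data.List.Properties as List
open import Data.List using (List; []; _∷_; _++_; length; reverse; [_]; map; foldr; filter)
open import Data.List.Properties
  using ( ++-assoc; ++-identityʳ; ∷-injective; ∷-injectiveˡ; ∷-injectiveʳ
        ; length-++; length-++-sucʳ; length-reverse; unfold-reverse; reverse-++; reverse-involutive
        ; filter-++; filter-accept; filter-reject; filter-none; foldr-++
        ; map-++; reverse-map; map-cong; map-id; map-∘ )
open import Data.List.Relation.Unary.All using (All; []; _∷_)
import Data.List.Relation.Unary.All as All
open import Data.List.Relation.Unary.All.Properties using (++⁺; ++⁻ˡ; ++⁻ʳ; ¬Any⇒All¬; All¬⇒¬Any)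
open import Data.List.Relation.Unary.Any using (Any; any?)
open import Data.List.Relation.Binary.Pointwise using (Pointwise; []; _∷_)
import Data.List.Relation.Binary.Pointwise as Pointwise
open import Data.Product using (∃-syntax; _×_; _,_; proj₁; proj₂)
open import Data.Sum using (_⊎_; inj₁; inj₂; [_,_]′)
open import Data.Empty using (⊥; ⊥-elim)
open import Data.Unit using (⊤; tt)
open import Data.Bool using (Bool; true; false; _xor_)
open import Data.Bool.Properties using (xor-assoc; xor-comm; xor-identityʳ; xor-same)
open import Relation.Nullary using (¬_; Dec; yes; no; does; ¬?; _→-dec_; _⊎-dec_)
open import Relation.Nullary.Decidable using (does-⇔; dec-true; dec-false; map′; decidable-stable)
open import Function.Bundles using (mk⇔)
open import Relation.Binary.PropositionalEquality
  using (_≡_; _≢_; refl; sym; trans; cong; cong₂; subst; subst₂; module ≡-Reasoning)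
open import Relation.Binary.Construct.Closure.Equivalence using (gmap)
  renaming (symmetric to ≈-symmetric; transitive to ≈-transitive)
open import Relation.Binary.Construct.Closure.ReflexiveTransitive using (Star; ε; _◅_)
open import Relation.Binary.Construct.Closure.Symmetric using (fwd; bwd)
open import Function using (_∘_)

n+n-injective : ∀ m n → m + m ≡ n + n → m ≡ n
n+n-injective zero    zero    _ = refl
n+n-injective (suc m) (suc n) e rewrite +-suc m m | +-suc n n =
  cong suc (n+n-injective m n (suc-injective (suc-injective e)))

n+n≢m+1+m : ∀ n m → n + n ≢ m + suc m
n+n≢m+1+m zero    zero    ()
n+n≢m+1+m (suc n) zero    e rewrite +-suc n n with suc-injective e
... | ()
n+n≢m+1+m (suc n) (suc m) e rewrite +-suc n n | +-suc m (suc m) =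
  n+n≢m+1+m n m (suc-injective (suc-injective e))

n+k+n-injective : ∀ {m n k l} → k ≤ 1 → l ≤ 1 → m + (k + m) ≡ n + (l + n) → (m ≡ n) × (k ≡ l)
n+k+n-injective {m} {n} z≤n       z≤n       e = n+n-injective m n e , refl
n+k+n-injective {m} {n} (s≤s z≤n) (s≤s z≤n) e =
  n+n-injective m n (suc-injective (trans (sym (+-suc m m)) (trans e (+-suc n n)))) , refl
n+k+n-injective {m} {n} z≤n       (s≤s z≤n) e = ⊥-elim (n+n≢m+1+m m n e)
n+k+n-injective {m} {n} (s≤s z≤n) z≤n       e = ⊥-elim (n+n≢m+1+m n m (sym e))

module _ {A : Set} where

  ++-≡-++ : ∀ (ws xs ys zs : List A) → ws ++ xs ≡ ys ++ zs →
            (∃[ γ ] (ws ≡ ys ++ γ) × (zs ≡ γ ++ xs)) ⊎ (∃[ μ ] (ys ≡ ws ++ μ) × (xs ≡ μ ++ zs))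
  ++-≡-++ []       xs ys       zs eq = inj₂ (ys , refl , eq)
  ++-≡-++ (w ∷ ws) xs []       zs eq = inj₁ (w ∷ ws , refl , sym eq)
  ++-≡-++ (w ∷ ws) xs (y ∷ ys) zs eq with ∷-injective eq
  ... | refl , eq′ with ++-≡-++ ws xs ys zs eq′
  ...   | inj₁ (γ , e₁ , e₂) = inj₁ (γ , cong (w ∷_) e₁ , e₂)
  ...   | inj₂ (μ , e₁ , e₂) = inj₂ (μ , cong (w ∷_) e₁ , e₂)

  []≢++∷ : ∀ (xs : List A) x ys → [] ≢ xs ++ x ∷ ys
  []≢++∷ []      x ys ()
  []≢++∷ (_ ∷ _) x ys ()

  ++-injective : ∀ (xs ys zs ws : List A) → length xs ≡ length ys →
                 xs ++ zs ≡ ys ++ ws → (xs ≡ ys) × (zs ≡ ws)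
  ++-injective []       []       zs ws _  e = refl , e
  ++-injective (x ∷ xs) (y ∷ ys) zs ws l e with ∷-injective e
  ... | refl , e′ with ++-injective xs ys zs ws (suc-injective l) e′
  ...   | refl , e″ = refl , e″

  length-∷ʳ : ∀ (xs : List A) x → length (xs ++ [ x ]) ≡ suc (length xs)
  length-∷ʳ xs x = trans (length-++ xs) (+-comm (length xs) 1)

  reverse-palindrome : ∀ (xs : List A) x → reverse (xs ++ x ∷ reverse xs) ≡ xs ++ x ∷ reverse xs
  reverse-palindrome xs x
    rewrite reverse-++ xs (x ∷ reverse xs) | unfold-reverse x (reverse xs) | reverse-involutive xs
    = ++-assoc xs [ x ] (reverse xs)

  reverse-∷-reverse : ∀ x (xs : List A) → reverse (x ∷ reverse xs) ≡ xs ++ [ x ]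
  reverse-∷-reverse x xs = trans (unfold-reverse x (reverse xs)) (cong (_++ [ x ]) (reverse-involutive xs))

  All-reverse⁺ : ∀ {P : A → Set} (xs : List A) → All P xs → All P (reverse xs)
  All-reverse⁺ []       []         = []
  All-reverse⁺ {P} (x ∷ xs) (px ∷ pxs) =
    subst (All P) (sym (unfold-reverse x xs)) (++⁺ (All-reverse⁺ xs pxs) (px ∷ []))

  All-reverse⁻ : ∀ {P : A → Set} (xs : List A) → All P (reverse xs) → All P xs
  All-reverse⁻ {P} xs ps = subst (All P) (reverse-involutive xs) (All-reverse⁺ (reverse xs) ps)

  palindrome-length : ∀ (xs e : List A) → length (xs ++ (e ++ reverse xs)) ≡ length xs + (length e + length xs)
  palindrome-length xs e =
    trans (length-++ xs) (cong (length xs +_) (trans (length-++ e) (cong (length e +_) (length-reverse xs))))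

  palindrome-injective : ∀ (xs ys e e′ : List A) → length e ≤ 1 → length e′ ≤ 1 →
                         xs ++ (e ++ reverse xs) ≡ ys ++ (e′ ++ reverse ys) → xs ++ e ≡ ys ++ e′
  palindrome-injective xs ys e e′ e≤1 e′≤1 eq
    with n+k+n-injective e≤1 e′≤1
           (trans (sym (palindrome-length xs e)) (trans (cong length eq) (palindrome-length ys e′)))
  ... | |xs|≡|ys| , |e|≡|e′| with ++-injective xs ys _ _ |xs|≡|ys| eq
  ...   | refl , eq′ = cong (xs ++_) (proj₁ (++-injective e e′ _ _ |e|≡|e′| eq′))

module Presentation {n : ℕ} (M : CoxeterMatrix n) where
  open Coxeter M

  ≈-refl : ∀ {x} → x ≈ x
  ≈-refl = ε

  ≈-sym : ∀ {x y} → x ≈ y → y ≈ x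
  ≈-sym = ≈-symmetric Rel

  ≈-trans : ∀ {x y z} → x ≈ y → y ≈ z → x ≈ z
  ≈-trans = ≈-transitive Rel

  ≡⇒≈ : ∀ {x y} → x ≡ y → x ≈ y
  ≡⇒≈ refl = ε

  Rel⇒≈ : ∀ {x y} → Rel x y → x ≈ y
  Rel⇒≈ r = fwd r ◅ ε

  Rel-++ˡ : ∀ c {x y} → Rel x y → Rel (c ++ x) (c ++ y)
  Rel-++ˡ c (cancel x y s) =
    subst₂ Rel (++-assoc c x _) (++-assoc c x y) (cancel (c ++ x) y s)
  Rel-++ˡ c (braid x y i j k i≢j mij) =
    subst₂ Rel (++-assoc c x _) (++-assoc c x _) (braid (c ++ x) y i j k i≢j mij)

  Rel-++ʳ : ∀ c {x y} → Rel x y → Rel (x ++ c) (y ++ c)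
  Rel-++ʳ c (cancel x y s) =
    subst₂ Rel (sym (++-assoc x (s ∷ s ∷ y) c)) (sym (++-assoc x y c)) (cancel x (y ++ c) s)
  Rel-++ʳ c (braid x y i j k i≢j mij) =
    subst₂ Rel (reassoc (alt i j k)) (reassoc (alt j i k)) (braid x (y ++ c) i j k i≢j mij)
    where
      reassoc : ∀ a → x ++ (a ++ (y ++ c)) ≡ (x ++ (a ++ y)) ++ c
      reassoc a = sym (trans (++-assoc x (a ++ y) c) (cong (x ++_) (++-assoc a y c)))

  ≈-++ˡ : ∀ c {x y} → x ≈ y → (c ++ x) ≈ (c ++ y)
  ≈-++ˡ c = gmap (c ++_) (Rel-++ˡ c)

  ≈-++ʳ : ∀ c {x y} → x ≈ y → (x ++ c) ≈ (y ++ c)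
  ≈-++ʳ c = gmap (_++ c) (Rel-++ʳ c)

  ≈-∷ : ∀ c {x y} → x ≈ y → (c ∷ x) ≈ (c ∷ y)
  ≈-∷ c = ≈-++ˡ [ c ]

  ≈-++ : ∀ {x x′ y y′} → x ≈ x′ → y ≈ y′ → (x ++ y) ≈ (x′ ++ y′)
  ≈-++ {x′ = x′} {y = y} p q = ≈-trans (≈-++ʳ y p) (≈-++ˡ x′ q)

  ss≈ε : ∀ s y → (s ∷ s ∷ y) ≈ y
  ss≈ε s y = Rel⇒≈ (cancel [] y s)

  ++-identityʳ-≈ : ∀ {r b} → b ≈ [] → (r ++ b) ≈ r
  ++-identityʳ-≈ {r} p = ≈-trans (≈-++ˡ r p) (≡⇒≈ (++-identityʳ r))

  reverse-inverseˡ : ∀ x → (reverse x ++ x) ≈ []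
  reverse-inverseˡ []      = ≈-refl
  reverse-inverseˡ (c ∷ x) rewrite unfold-reverse c x | ++-assoc (reverse x) [ c ] (c ∷ x) =
    ≈-trans (≈-++ˡ (reverse x) (ss≈ε c x)) (reverse-inverseˡ x)

  reverse-inverseʳ : ∀ x → (x ++ reverse x) ≈ []
  reverse-inverseʳ []      = ≈-refl
  reverse-inverseʳ (c ∷ x) rewrite unfold-reverse c x | sym (++-assoc x (reverse x) [ c ]) =
    ≈-trans (≈-∷ c (≈-++ʳ [ c ] (reverse-inverseʳ x))) (ss≈ε c [])

  conj : Word → Word → Word
  conj x r = x ++ (r ++ reverse x)

  unconj : Word → Word → Word
  unconj x t = reverse x ++ (t ++ x)

  conj-≈ : ∀ x {a b} → a ≈ b → conj x a ≈ conj x b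
  conj-≈ x p = ≈-++ˡ x (≈-++ʳ (reverse x) p)

  unconj-≈ : ∀ x {a b} → a ≈ b → unconj x a ≈ unconj x b
  unconj-≈ x p = ≈-++ˡ (reverse x) (≈-++ʳ x p)

  private
    sandwich : ∀ {a b} → a ≈ [] → b ≈ [] → ∀ r → (a ++ (r ++ b)) ≈ r
    sandwich {b = b} pa pb r = ≈-trans (≈-++ʳ (r ++ b) pa) (++-identityʳ-≈ pb)

    reassoc : ∀ (p q r s v : Word) → p ++ ((q ++ (r ++ s)) ++ v) ≡ (p ++ q) ++ (r ++ (s ++ v))
    reassoc p q r s v rewrite ++-assoc q (r ++ s) v | ++-assoc r s v = sym (++-assoc p q (r ++ (s ++ v)))

  unconj-conj : ∀ x r → unconj x (conj x r) ≈ r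
  unconj-conj x r rewrite reassoc (reverse x) x r (reverse x) x =
    sandwich (reverse-inverseˡ x) (reverse-inverseˡ x) r

  conj-unconj : ∀ x t → conj x (unconj x t) ≈ t
  conj-unconj x t rewrite reassoc x (reverse x) t x (reverse x) =
    sandwich (reverse-inverseʳ x) (reverse-inverseʳ x) t

  conj-∷ : ∀ c (a r : Word) → conj [ c ] (conj a r) ≡ conj (c ∷ a) r
  conj-∷ c a r rewrite unfold-reverse c a | ++-assoc a (r ++ reverse a) [ c ] | ++-assoc r (reverse a) [ c ] = refl

  reflection-involutive : ∀ {t} → IsReflection t → (t ++ t) ≈ []
  reflection-involutive (w , s , t≈) =
    ≈-trans (≈-++ t≈ t≈)
      (subst (λ z → ((w ++ s ∷ reverse w) ++ z) ≈ []) (reverse-palindrome w s)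
             (reverse-inverseʳ (w ++ s ∷ reverse w)))

module RightAngledCoxeter {n : ℕ} (M : CoxeterMatrix n) (RA : RightAngled M) where
  open CoxeterMatrix M using (m; diag; offdiag) renaming (sym to m-sym)
  open Coxeter M
  open Presentation M

  Commute : Fin n → Fin n → Set
  Commute a b = m a b ≡ just 2

  ¬Commute : Fin n → Fin n → Set
  ¬Commute a b = ¬ Commute a b

  commute? : ∀ a b → Dec (Commute a b)
  commute? a b = Maybe.≡-dec _≟ℕ_ (m a b) (just 2)

  commute-sym : ∀ {a b} → Commute a b → Commute b a
  commute-sym {a} {b} c = trans (m-sym b a) c

  commute-irrefl : ∀ {a} → ¬ Commute a a
  commute-irrefl {a} c with trans (sym (diag a)) c
  ... | ()

  commute⇒≢ : ∀ {a b} → Commute a b → a ≢ b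
  commute⇒≢ c refl = commute-irrefl c

  braid-length≡2 : ∀ i j k → i ≢ j → m i j ≡ just k → k ≡ 2
  braid-length≡2 i j k i≢j mij with RA i j
  ... | inj₁ mij≡1 with offdiag i j i≢j k mij | trans (sym mij) mij≡1
  ...   | s≤s () | refl
  braid-length≡2 i j k i≢j mij | inj₂ (inj₁ mij≡2) = just-injective (trans (sym mij) mij≡2)
  braid-length≡2 i j k i≢j mij | inj₂ (inj₂ mij≡∞) with trans (sym mij) mij≡∞
  ... | ()

  commute-≈ : ∀ {a b} y → Commute a b → (a ∷ b ∷ y) ≈ (b ∷ a ∷ y)
  commute-≈ {a} {b} y c = Rel⇒≈ (braid [] y a b 2 (commute⇒≢ c) c)

  aba≈b : ∀ {a b} → Commute a b → (a ∷ b ∷ a ∷ []) ≈ [ b ]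
  aba≈b {a} {b} ab = ≈-trans (commute-≈ [ a ] ab) (≈-∷ b (ss≈ε a []))

  commute-past : ∀ {s} u γ → All (Commute s) u → (s ∷ (u ++ γ)) ≈ (u ++ (s ∷ γ))
  commute-past []      γ []       = ≈-refl
  commute-past (x ∷ u) γ (c ∷ cs) = ≈-trans (commute-≈ (u ++ γ) c) (≈-∷ x (commute-past u γ cs))

  InPair : Fin n → Fin n → Fin n → Set
  InPair a b x = x ≡ a ⊎ x ≡ b

  inPair? : ∀ a b x → Dec (InPair a b x)
  inPair? a b x = (x ≟F a) ⊎-dec (x ≟F b)

  π : Fin n → Fin n → Word → Word
  π a b = filter (inPair? a b)

  π-++ : ∀ a b (x y : Word) → π a b (x ++ y) ≡ π a b x ++ π a b y
  π-++ a b = filter-++ (inPair? a b)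

  π-accept : ∀ {a b x} w → InPair a b x → π a b (x ∷ w) ≡ x ∷ π a b w
  π-accept {a} {b} w = filter-accept (inPair? a b)

  π-reject : ∀ {a b x} w → ¬ InPair a b x → π a b (x ∷ w) ≡ π a b w
  π-reject {a} {b} w = filter-reject (inPair? a b)

  π-reverse : ∀ a b (w : Word) → π a b (reverse w) ≡ reverse (π a b w)
  π-reverse a b []      = refl
  π-reverse a b (x ∷ w) = begin
    π a b (reverse (x ∷ w))            ≡⟨ cong (π a b) (unfold-reverse x w) ⟩
    π a b (reverse w ++ [ x ])         ≡⟨ π-++ a b (reverse w) [ x ] ⟩
    π a b (reverse w) ++ π a b [ x ]   ≡⟨ cong (_++ π a b [ x ]) (π-reverse a b w) ⟩
    reverse (π a b w) ++ π a b [ x ]   ≡⟨ last (inPair? a b x) ⟩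
    reverse (π a b (x ∷ w))            ∎
    where
      open ≡-Reasoning
      last : (d : Dec (InPair a b x)) →
             reverse (π a b w) ++ π a b [ x ] ≡ reverse (π a b (x ∷ w))
      last (yes p) rewrite π-accept {a} {b} [] p | π-accept w p = sym (unfold-reverse x (π a b w))
      last (no ¬p) rewrite π-reject {a} {b} [] ¬p | π-reject w ¬p = ++-identityʳ _

  π-commuting : ∀ {s a b} (u : Word) → All (Commute s) u → InPair a b s → ¬Commute a b → π a b u ≡ []
  π-commuting {s} {a} {b} u cs s∈ab ¬ab = filter-none (inPair? a b) (All.map (outside s∈ab) cs)
    where
      outside : InPair a b s → ∀ {x} → Commute s x → ¬ InPair a b x
      outside (inj₁ refl) c (inj₁ refl) = commute-irrefl c
      outside (inj₂ refl) c (inj₁ refl) = ¬ab (commute-sym c)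
      outside (inj₁ refl) c (inj₂ refl) = ¬ab c
      outside (inj₂ refl) c (inj₂ refl) = commute-irrefl c

  -- Finer than _≈_ on arbitrary words (s s and [] differ), but equivalent to it on reduced ones.
  record _≈π_ (r r′ : Word) : Set where
    constructor mk≈π
    field π-≡ : ∀ a b → ¬Commute a b → π a b r ≡ π a b r′
  open _≈π_

  ≈π-refl : ∀ {r} → r ≈π r
  ≈π-refl = mk≈π λ _ _ _ → refl

  ≈π-sym : ∀ {r r′} → r ≈π r′ → r′ ≈π r
  ≈π-sym e = mk≈π λ a b ¬ab → sym (π-≡ e a b ¬ab)

  ≈π-trans : ∀ {r r′ r″} → r ≈π r′ → r′ ≈π r″ → r ≈π r″
  ≈π-trans e f = mk≈π λ a b ¬ab → trans (π-≡ e a b ¬ab) (π-≡ f a b ¬ab)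

  Cancels : Fin n → Word → Set
  Cancels s w = ∃[ u ] ∃[ β ] (w ≡ u ++ s ∷ β) × All (Commute s) u

  remove : ∀ {s w} → Cancels s w → Word
  remove (u , β , _ , _) = u ++ β

  cancels? : ∀ s w → Dec (Cancels s w)
  cancels? s []      = no λ { (u , β , eq , _) → []≢++∷ u s β eq }
  cancels? s (x ∷ w) with x ≟F s
  ... | yes refl = yes ([] , w , refl , [])
  ... | no x≢s with commute? s x
  ...   | no ¬c = no λ { ([] , β , eq , _) → x≢s (∷-injectiveˡ eq)
                       ; (y ∷ u , β , eq , c ∷ _) → ¬c (subst (Commute s) (sym (∷-injectiveˡ eq)) c) }
  ...   | yes c with cancels? s w
  ...     | yes (u , β , eq , cs) = yes (x ∷ u , β , cong (x ∷_) eq , c ∷ cs)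
  ...     | no ¬h = no λ { ([] , β , eq , _) → x≢s (∷-injectiveˡ eq)
                         ; (y ∷ u , β , eq , _ ∷ cs) → ¬h (u , β , ∷-injectiveʳ eq , cs) }

  π-remove-inPair : ∀ {s w a b} (h : Cancels s w) → ¬Commute a b → InPair a b s →
                    π a b w ≡ s ∷ π a b (remove h)
  π-remove-inPair {s} {a = a} {b} (u , β , refl , cs) ¬ab s∈ab = begin
    π a b (u ++ s ∷ β)            ≡⟨ π-++ a b u (s ∷ β) ⟩
    π a b u ++ π a b (s ∷ β)      ≡⟨ cong (_++ π a b (s ∷ β)) πu≡[] ⟩
    π a b (s ∷ β)                 ≡⟨ π-accept β s∈ab ⟩
    s ∷ π a b β                   ≡⟨ cong (λ l → s ∷ (l ++ π a b β)) (sym πu≡[]) ⟩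
    s ∷ (π a b u ++ π a b β)      ≡⟨ cong (s ∷_) (sym (π-++ a b u β)) ⟩
    s ∷ π a b (u ++ β)            ∎
    where
      open ≡-Reasoning
      πu≡[] : π a b u ≡ []
      πu≡[] = π-commuting u cs s∈ab ¬ab

  π-remove-∉Pair : ∀ {s w a b} (h : Cancels s w) → ¬ InPair a b s → π a b w ≡ π a b (remove h)
  π-remove-∉Pair {s} {a = a} {b} (u , β , refl , cs) s∉ab =
    trans (π-++ a b u (s ∷ β)) (trans (cong (π a b u ++_) (π-reject β s∉ab)) (sym (π-++ a b u β)))

  π-head⇒cancels : ∀ {s} w → (∀ d → ¬Commute s d → ∃[ l ] π s d w ≡ s ∷ l) → Cancels s w
  π-head⇒cancels {s} [] heads with heads s commute-irrefl
  ... | _ , ()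
  π-head⇒cancels {s} (x ∷ w) heads = go (x ≟F s) (commute? s x)
    where
      go : Dec (x ≡ s) → Dec (Commute s x) → Cancels s (x ∷ w)
      go (yes refl) _ = [] , w , refl , []
      go (no x≢s) (no ¬c) =
        ⊥-elim (x≢s (∷-injectiveˡ (trans (sym (π-accept {s} {x} w (inj₂ refl))) (proj₂ (heads x ¬c)))))
      go (no x≢s) (yes c) with π-head⇒cancels w (λ d ¬sd → proj₁ (heads d ¬sd) ,
                                 trans (sym (π-reject w (x∉sd ¬sd))) (proj₂ (heads d ¬sd)))
        where
          x∉sd : ∀ {d} → ¬Commute s d → ¬ InPair s d x
          x∉sd _   (inj₁ x≡s) = x≢s x≡s
          x∉sd ¬sd (inj₂ refl) = ¬sd c
      ... | u , β , eq , cs = x ∷ u , β , cong (x ∷_) eq , c ∷ cs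

  cancels-resp-π : ∀ {s w w′} → (∀ d → ¬Commute s d → π s d w ≡ π s d w′) →
                   Cancels s w → Cancels s w′
  cancels-resp-π e h =
    π-head⇒cancels _ λ d ¬sd → π _ d (remove h) , trans (sym (e d ¬sd)) (π-remove-inPair h ¬sd (inj₁ refl))

  cancels-resp-≈π : ∀ {s w w′} → w ≈π w′ → Cancels s w → Cancels s w′
  cancels-resp-≈π {s} e = cancels-resp-π (π-≡ e s)

  cancels-++⁻ : ∀ {s} u β → All (Commute s) u → Cancels s (u ++ β) → Cancels s β
  cancels-++⁻ {s} u β cs (u′ , β′ , eq , cs′) with ++-≡-++ u β u′ (s ∷ β′) eq
  ... | inj₁ ([] , _ , e₂) = [] , β′ , sym e₂ , []
  ... | inj₁ (g ∷ γ , e₁ , e₂) with ∷-injective e₂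
  ...   | refl , _ with ++⁻ʳ u′ (subst (All (Commute s)) e₁ cs)
  ...     | c ∷ _ = ⊥-elim (commute-irrefl c)
  cancels-++⁻ {s} u β cs (u′ , β′ , eq , cs′) | inj₂ (μ , e₁ , e₂) =
    μ , β′ , e₂ , ++⁻ʳ u (subst (All (Commute s)) e₁ cs′)

  remove-head : ∀ {s r} (h : Cancels s (s ∷ r)) → remove h ≡ r
  remove-head ([] , β , eq , _) = sym (∷-injectiveʳ eq)
  remove-head (x ∷ u , β , eq , c ∷ _) with ∷-injectiveˡ eq
  ... | refl = ⊥-elim (commute-irrefl c)

  push : Fin n → Word → Word
  push s r with cancels? s r
  ... | yes h = remove h
  ... | no _  = s ∷ r

  normalForm : Word → Word
  normalForm = foldr push []

  push-inPair : ∀ {s r a b} → Cancels s r → ¬Commute a b → InPair a b s →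
                π a b r ≡ s ∷ π a b (push s r)
  push-inPair {s} {r} h ¬ab s∈ab with cancels? s r
  ... | yes h′ = π-remove-inPair h′ ¬ab s∈ab
  ... | no ¬h  = ⊥-elim (¬h h)

  push-∉Pair : ∀ {s r a b} → ¬ InPair a b s → π a b (push s r) ≡ π a b r
  push-∉Pair {s} {r} s∉ab with cancels? s r
  ... | yes h = sym (π-remove-∉Pair h s∉ab)
  ... | no _  = π-reject r s∉ab

  push-prepends : ∀ {s r} → ¬ Cancels s r → push s r ≡ s ∷ r
  push-prepends {s} {r} ¬h with cancels? s r
  ... | yes h = ⊥-elim (¬h h)
  ... | no _  = refl

  push-≈π : ∀ {s r r′} → r ≈π r′ → push s r ≈π push s r′
  push-≈π {s} {r} {r′} e = mk≈π pointwise
    where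
      pointwise : ∀ a b → ¬Commute a b → π a b (push s r) ≡ π a b (push s r′)
      pointwise a b ¬ab with cancels? s r | inPair? a b s
      ... | yes h | yes s∈ab =
        ∷-injectiveʳ (trans (sym (π-remove-inPair h ¬ab s∈ab))
                            (trans (π-≡ e a b ¬ab) (push-inPair {s} {r′} (cancels-resp-≈π e h) ¬ab s∈ab)))
      ... | yes h | no s∉ab =
        trans (sym (π-remove-∉Pair h s∉ab)) (trans (π-≡ e a b ¬ab) (sym (push-∉Pair {s} {r′} s∉ab)))
      ... | no ¬h | s∈ab? rewrite push-prepends {s} {r′} (¬h ∘ cancels-resp-≈π (≈π-sym e)) with s∈ab?
      ...   | yes s∈ab =
        trans (π-accept r s∈ab) (trans (cong (s ∷_) (π-≡ e a b ¬ab)) (sym (π-accept r′ s∈ab)))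
      ...   | no s∉ab  = trans (π-reject r s∉ab) (trans (π-≡ e a b ¬ab) (sym (π-reject r′ s∉ab)))

  Reducible : Word → Set
  Reducible w = ∃[ α ] ∃[ c ] ∃[ w′ ] (w ≡ α ++ c ∷ w′) × Cancels c w′

  Reduced : Word → Set
  Reduced w = ¬ Reducible w

  reducible-∷⁻ : ∀ {c w} → Reducible (c ∷ w) → Cancels c w ⊎ Reducible w
  reducible-∷⁻ ([] , c , w′ , eq , h) with ∷-injective eq
  ... | refl , refl = inj₁ h
  reducible-∷⁻ (a ∷ α , c , w′ , eq , h) = inj₂ (α , c , w′ , ∷-injectiveʳ eq , h)

  reducible-here : ∀ {c w} → Cancels c w → Reducible (c ∷ w)
  reducible-here {c} {w} h = [] , c , w , refl , h

  reduced-tail : ∀ {c w} → Reduced (c ∷ w) → Reduced w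
  reduced-tail r (α , c , w′ , eq , h) = r (_ ∷ α , c , w′ , cong (_ ∷_) eq , h)

  reduced-[] : Reduced []
  reduced-[] (α , c , w′ , eq , _) = []≢++∷ α c w′ eq

  cancels-insert : ∀ {c s} μ β → Commute c s → Cancels c (μ ++ β) → Cancels c (μ ++ s ∷ β)
  cancels-insert {c} {s} μ β cs (u , β′ , eq , cu) with ++-≡-++ μ β u (c ∷ β′) eq
  ... | inj₁ ([] , e₁ , e₂) =
    μ ++ [ s ] , β′ , split , ++⁺ (subst (All (Commute c)) (sym (trans e₁ (++-identityʳ u))) cu) (cs ∷ [])
    where
      split : μ ++ s ∷ β ≡ (μ ++ [ s ]) ++ c ∷ β′
      split rewrite ++-assoc μ [ s ] (c ∷ β′) | e₂ = refl
  ... | inj₁ (g ∷ γ , e₁ , e₂) with ∷-injective e₂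
  ...   | refl , _ = u , γ ++ s ∷ β , split , cu
    where
      split : μ ++ s ∷ β ≡ u ++ g ∷ (γ ++ s ∷ β)
      split rewrite e₁ = ++-assoc u (g ∷ γ) (s ∷ β)
  cancels-insert {c} {s} μ β cs (u , β′ , eq , cu) | inj₂ (ν , e₁ , e₂) =
    μ ++ s ∷ ν , β′ , split , ++⁺ (++⁻ˡ μ cμν) (cs ∷ ++⁻ʳ μ cμν)
    where
      cμν : All (Commute c) (μ ++ ν)
      cμν = subst (All (Commute c)) e₁ cu
      split : μ ++ s ∷ β ≡ (μ ++ s ∷ ν) ++ c ∷ β′
      split rewrite e₂ = sym (++-assoc μ (s ∷ ν) (c ∷ β′))

  reducible-insert : ∀ {s} u β → All (Commute s) u → Reducible (u ++ β) → Reducible (u ++ s ∷ β)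
  reducible-insert {s} u β cs (α , c , w′ , eq , h) with ++-≡-++ u β α (c ∷ w′) eq
  ... | inj₁ ([] , e₁ , e₂) = u ++ [ s ] , c , w′ , split , h
    where
      split : u ++ s ∷ β ≡ (u ++ [ s ]) ++ c ∷ w′
      split rewrite ++-assoc u [ s ] (c ∷ w′) | e₂ = refl
  ... | inj₁ (g ∷ γ , e₁ , e₂) with ∷-injective e₂ | ++⁻ʳ α (subst (All (Commute s)) e₁ cs)
  ...   | refl , e₃ | sg ∷ _ =
    α , g , γ ++ s ∷ β , split , cancels-insert γ β (commute-sym sg) (subst (Cancels g) e₃ h)
    where
      split : u ++ s ∷ β ≡ α ++ g ∷ (γ ++ s ∷ β)
      split rewrite e₁ = ++-assoc α (g ∷ γ) (s ∷ β)
  reducible-insert {s} u β cs (α , c , w′ , eq , h) | inj₂ (μ , e₁ , e₂) = u ++ s ∷ μ , c , w′ , split , h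
    where
      split : u ++ s ∷ β ≡ (u ++ s ∷ μ) ++ c ∷ w′
      split rewrite e₂ = sym (++-assoc u (s ∷ μ) (c ∷ w′))

  push-reduced : ∀ {s r} → Reduced r → Reduced (push s r)
  push-reduced {s} {r} red-r with cancels? s r
  ... | yes (u , β , refl , cs) = red-r ∘ reducible-insert u β cs
  ... | no ¬h = λ red → [ ¬h , red-r ]′ (reducible-∷⁻ red)

  normalForm-reduced : ∀ w → Reduced (normalForm w)
  normalForm-reduced []      = reduced-[]
  normalForm-reduced (s ∷ w) = push-reduced (normalForm-reduced w)

  push-∷-same : ∀ s r → push s (s ∷ r) ≡ r
  push-∷-same s r with cancels? s (s ∷ r)
  ... | yes h = remove-head h
  ... | no ¬h = ⊥-elim (¬h ([] , r , refl , []))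

  push-push-same : ∀ {s r} → Reduced r → push s (push s r) ≈π r
  push-push-same {s} {r} red-r with cancels? s r
  ... | no _ = subst (_≈π r) (sym (push-∷-same s r)) ≈π-refl
  ... | yes h@(u , β , refl , cs)
    rewrite push-prepends {s} {u ++ β} (λ h′ → red-r (u , s , β , refl , cancels-++⁻ u β cs h′))
    = mk≈π restore
    where
      restore : ∀ a b → ¬Commute a b → π a b (s ∷ (u ++ β)) ≡ π a b (u ++ s ∷ β)
      restore a b ¬ab with inPair? a b s
      ... | yes s∈ab = trans (π-accept (u ++ β) s∈ab) (sym (π-remove-inPair h ¬ab s∈ab))
      ... | no s∉ab  = trans (π-reject (u ++ β) s∉ab) (sym (π-remove-∉Pair h s∉ab))

  π-push-commuting : ∀ {a b} r → Commute a b → ∀ d → ¬Commute a d → π a d (push b r) ≡ π a d r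
  π-push-commuting {a} {b} r ab d ¬ad = push-∉Pair {b} {r} b∉ad
    where
      b∉ad : ¬ InPair a d b
      b∉ad (inj₁ b≡a) = commute⇒≢ ab (sym b≡a)
      b∉ad (inj₂ refl) = ¬ad ab

  private
    push-push-one-side : ∀ {a b x y} r → Commute a b → ¬Commute x y → ¬ InPair x y b →
                         π x y (push a (push b r)) ≡ π x y (push b (push a r))
    push-push-one-side {a} {b} {x} {y} r ab ¬xy b∉xy =
      trans (pass-b (inPair? x y a)) (sym (push-∉Pair {b} {push a r} b∉xy))
      where
        pass-b : Dec (InPair x y a) → π x y (push a (push b r)) ≡ π x y (push a r)
        pass-b (no a∉xy) =
          trans (push-∉Pair {a} {push b r} a∉xy)
                (trans (push-∉Pair {b} {r} b∉xy) (sym (push-∉Pair {a} {r} a∉xy)))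
        pass-b (yes a∈xy) with cancels? a r
        ... | yes h =
          ∷-injectiveʳ (trans (sym (push-inPair {a} {push b r}
                                     (cancels-resp-π (λ d ¬ad → sym (π-push-commuting r ab d ¬ad)) h) ¬xy a∈xy))
                              (trans (push-∉Pair {b} {r} b∉xy) (π-remove-inPair h ¬xy a∈xy)))
        ... | no ¬h
          rewrite push-prepends {a} {push b r} (¬h ∘ cancels-resp-π (π-push-commuting r ab))
          = trans (π-accept (push b r) a∈xy)
                  (trans (cong (a ∷_) (push-∉Pair {b} {r} b∉xy)) (sym (π-accept r a∈xy)))

  push-push-commute : ∀ {a b} r → Commute a b → push a (push b r) ≈π push b (push a r)
  push-push-commute {a} {b} r ab = mk≈π λ x y ¬xy → go x y ¬xy (inPair? x y b) (inPair? x y a)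
    where
      go : ∀ x y → ¬Commute x y → Dec (InPair x y b) → Dec (InPair x y a) →
           π x y (push a (push b r)) ≡ π x y (push b (push a r))
      go x y ¬xy (no b∉xy) _        = push-push-one-side r ab ¬xy b∉xy
      go x y ¬xy (yes _)  (no a∉xy) = sym (push-push-one-side r (commute-sym ab) ¬xy a∉xy)
      go x y ¬xy (yes b∈xy) (yes a∈xy) = ⊥-elim (both a∈xy b∈xy)
        where
          both : InPair x y a → InPair x y b → ⊥
          both (inj₁ refl) (inj₁ refl) = commute-irrefl ab
          both (inj₁ refl) (inj₂ refl) = ¬xy ab
          both (inj₂ refl) (inj₁ refl) = ¬xy (commute-sym ab)
          both (inj₂ refl) (inj₂ refl) = commute-irrefl ab

  foldr-push-≈π : ∀ x {r r′} → r ≈π r′ → foldr push r x ≈π foldr push r′ x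
  foldr-push-≈π []      e = e
  foldr-push-≈π (c ∷ x) e = push-≈π (foldr-push-≈π x e)

  normalForm-++ : ∀ x z → normalForm (x ++ z) ≡ foldr push (normalForm z) x
  normalForm-++ x z = foldr-++ push [] x z

  Rel⇒normalForm-≈π : ∀ {x y} → Rel x y → normalForm x ≈π normalForm y
  Rel⇒normalForm-≈π (cancel x y s) rewrite normalForm-++ x (s ∷ s ∷ y) | normalForm-++ x y =
    foldr-push-≈π x (push-push-same (normalForm-reduced y))
  Rel⇒normalForm-≈π (braid x y i j k i≢j mij) with braid-length≡2 i j k i≢j mij
  ... | refl rewrite normalForm-++ x (i ∷ j ∷ y) | normalForm-++ x (j ∷ i ∷ y) =
    foldr-push-≈π x (push-push-commute (normalForm y) mij)

  ≈⇒normalForm-≈π : ∀ {x y} → x ≈ y → normalForm x ≈π normalForm y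
  ≈⇒normalForm-≈π ε              = ≈π-refl
  ≈⇒normalForm-≈π (fwd r ◅ rest) = ≈π-trans (Rel⇒normalForm-≈π r) (≈⇒normalForm-≈π rest)
  ≈⇒normalForm-≈π (bwd r ◅ rest) =
    ≈π-trans (≈π-sym (Rel⇒normalForm-≈π r)) (≈⇒normalForm-≈π rest)

  push-≈ : ∀ s r → push s r ≈ (s ∷ r)
  push-≈ s r with cancels? s r
  ... | yes (u , β , refl , cs) = ≈-sym (≈-trans (commute-past u (s ∷ β) cs) (≈-++ˡ u (ss≈ε s β)))
  ... | no _ = ≈-refl

  normalForm-≈ : ∀ w → normalForm w ≈ w
  normalForm-≈ []      = ≈-refl
  normalForm-≈ (s ∷ w) = ≈-trans (push-≈ s (normalForm w)) (≈-∷ s (normalForm-≈ w))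

  push-length : ∀ s r → length (push s r) ≤ suc (length r)
  push-length s r with cancels? s r
  ... | yes (u , β , refl , cs) rewrite length-++ u {β} | length-++ u {s ∷ β} =
    m≤n⇒m≤1+n (+-monoʳ-≤ (length u) (n≤1+n (length β)))
  ... | no _ = ≤-refl

  normalForm-length : ∀ w → length (normalForm w) ≤ length w
  normalForm-length []      = z≤n
  normalForm-length (s ∷ w) = ≤-trans (push-length s (normalForm w)) (s≤s (normalForm-length w))

  ≈π-cancel : ∀ {s r w} (h : Cancels s w) → (s ∷ r) ≈π w → r ≈π remove h
  ≈π-cancel {s} {r} h e = mk≈π pointwise
    where
      pointwise : ∀ a b → ¬Commute a b → π a b r ≡ π a b (remove h)
      pointwise a b ¬ab with inPair? a b s
      ... | yes s∈ab =
        ∷-injectiveʳ (trans (sym (π-accept r s∈ab)) (trans (π-≡ e a b ¬ab) (π-remove-inPair h ¬ab s∈ab)))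
      ... | no s∉ab = trans (sym (π-reject r s∉ab)) (trans (π-≡ e a b ¬ab) (π-remove-∉Pair h s∉ab))

  ≈π⇒≈ : ∀ r {r′} → r ≈π r′ → (r ≈ r′) × (length r ≡ length r′)
  ≈π⇒≈ []      {[]}     e = ≈-refl , refl
  ≈π⇒≈ []      {x ∷ r′} e with trans (π-≡ e x x commute-irrefl) (π-accept {x} {x} r′ (inj₁ refl))
  ... | ()
  ≈π⇒≈ (s ∷ r) {r′} e with cancels-resp-≈π e ([] , r , refl , [])
  ... | h@(u , β , refl , cs) with ≈π⇒≈ r (≈π-cancel h e)
  ...   | r≈uβ , |r|≡|uβ| =
    ≈-trans (≈-∷ s r≈uβ) (commute-past u β cs) ,
    trans (cong suc |r|≡|uβ|) (sym (length-++-sucʳ u s β))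

  normalForm-≈π⇒≈ : ∀ {x y} → normalForm x ≈π normalForm y → x ≈ y
  normalForm-≈π⇒≈ {x} {y} e =
    ≈-trans (≈-sym (normalForm-≈ x)) (≈-trans (proj₁ (≈π⇒≈ (normalForm x) e)) (normalForm-≈ y))

  ℓ : Word → ℕ
  ℓ w = length (normalForm w)

  ℓ-resp-≈ : ∀ {x y} → x ≈ y → ℓ x ≡ ℓ y
  ℓ-resp-≈ {x} p = proj₂ (≈π⇒≈ (normalForm x) (≈⇒normalForm-≈π p))

  ℓ-minimal : ∀ {w y} → y ≈ w → ℓ w ≤ length y
  ℓ-minimal {w} {y} p = subst (_≤ length y) (ℓ-resp-≈ p) (normalForm-length y)

  hasLength-ℓ : ∀ w → HasLength w (ℓ w)
  hasLength-ℓ w = (normalForm w , normalForm-≈ w , refl) , λ y p → ℓ-minimal p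

  hasLength⇒≡ℓ : ∀ {w k} → HasLength w k → k ≡ ℓ w
  hasLength⇒≡ℓ {w} ((x , x≈w , refl) , minimal) =
    ≤-antisym (minimal (normalForm w) (normalForm-≈ w)) (ℓ-minimal x≈w)

  geodesic⇒reduced : ∀ {z} → (∀ y → y ≈ z → length z ≤ length y) → Reduced z
  geodesic⇒reduced geodesic (α , c , _ , refl , (u , β , refl , cs)) =
    1+n≰n (≤-trans (n≤1+n _) (subst (_≤ length shorter) longer≡ (geodesic shorter shorter≈)))
    where
      shorter : Word
      shorter = α ++ (u ++ β)
      shorter≈ : shorter ≈ (α ++ c ∷ (u ++ c ∷ β))
      shorter≈ = ≈-++ˡ α (≈-sym (≈-trans (commute-past u (c ∷ β) cs) (≈-++ˡ u (ss≈ε c β))))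
      longer≡ : length (α ++ c ∷ (u ++ c ∷ β)) ≡ suc (suc (length shorter))
      longer≡ = trans (length-++-sucʳ α c (u ++ c ∷ β))
                  (cong suc (trans (cong length (sym (++-assoc α u (c ∷ β))))
                    (trans (length-++-sucʳ (α ++ u) c β) (cong (suc ∘ length) (++-assoc α u β)))))

  ≈π? : ∀ r r′ → Dec (r ≈π r′)
  ≈π? r r′ = map′ mk≈π π-≡
    (all? λ a → all? λ b → ¬? (commute? a b) →-dec List.≡-dec _≟F_ (π a b r) (π a b r′))

  _≈?_ : ∀ x y → Dec (x ≈ y)
  x ≈? y = map′ normalForm-≈π⇒≈ ≈⇒normalForm-≈π (≈π? (normalForm x) (normalForm y))

  ≈?-resp : ∀ {a a′ b b′} → a ≈ a′ → b ≈ b′ → does (a ≈? b) ≡ does (a′ ≈? b′)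
  ≈?-resp p q =
    does-⇔ (mk⇔ (λ r → ≈-trans (≈-sym p) (≈-trans r q)) (λ r → ≈-trans p (≈-trans r (≈-sym q))))
           (_ ≈? _) (_ ≈? _)

  -- Bourbaki's N(w) is the symmetric difference of the reflections in reflectionSequence w;
  -- parity t decides t ∈ N(w).
  reflectionSequence : Word → List Word
  reflectionSequence []      = []
  reflectionSequence (c ∷ w) = [ c ] ∷ map (conj [ c ]) (reflectionSequence w)

  parity : Word → List Word → Bool
  parity t []      = false
  parity t (r ∷ A) = does (t ≈? r) xor parity t A

  parity-∷-≉ : ∀ {t r} A → ¬ t ≈ r → parity t (r ∷ A) ≡ parity t A
  parity-∷-≉ {t} {r} A t≉r = cong (_xor parity t A) (dec-false (t ≈? r) t≉r)

  parity-++ : ∀ t A B → parity t (A ++ B) ≡ parity t A xor parity t B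
  parity-++ t []      B = refl
  parity-++ t (r ∷ A) B rewrite parity-++ t A B = sym (xor-assoc (does (t ≈? r)) (parity t A) (parity t B))

  parity-map-conj : ∀ t x A → parity t (map (conj x) A) ≡ parity (unconj x t) A
  parity-map-conj t x []      = refl
  parity-map-conj t x (r ∷ A) = cong₂ _xor_ conj-moves (parity-map-conj t x A)
    where
      conj-moves : does (t ≈? conj x r) ≡ does (unconj x t ≈? r)
      conj-moves = does-⇔ (mk⇔ (λ p → ≈-trans (unconj-≈ x p) (unconj-conj x r))
                               (λ p → ≈-trans (≈-sym (conj-unconj x t)) (conj-≈ x p)))
                          (_ ≈? _) (_ ≈? _)

  parity-resp-≈ : ∀ {t t′} A → t ≈ t′ → parity t A ≡ parity t′ A
  parity-resp-≈ []      p = refl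
  parity-resp-≈ {t} {t′} (r ∷ A) p = cong₂ _xor_ (≈?-resp {t} {t′} {r} p ≈-refl) (parity-resp-≈ A p)

  parity-Pointwise : ∀ t {A B} → Pointwise _≈_ A B → parity t A ≡ parity t B
  parity-Pointwise t []       = refl
  parity-Pointwise t (_∷_ {x = r} {y = r′} p ps) =
    cong₂ _xor_ (≈?-resp {t} {t} {r} {r′} ≈-refl p) (parity-Pointwise t ps)

  parity-reverse : ∀ t A → parity t (reverse A) ≡ parity t A
  parity-reverse t []      = refl
  parity-reverse t (r ∷ A)
    rewrite unfold-reverse r A | parity-++ t (reverse A) [ r ] | parity-reverse t A
          | xor-identityʳ (does (t ≈? r))
    = xor-comm (parity t A) (does (t ≈? r))

  reflectionSequence-++ : ∀ x z →
    reflectionSequence (x ++ z) ≡ reflectionSequence x ++ map (conj x) (reflectionSequence z)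
  reflectionSequence-++ []      z =
    sym (trans (map-cong ++-identityʳ (reflectionSequence z)) (map-id (reflectionSequence z)))
  reflectionSequence-++ (c ∷ x) z
    rewrite reflectionSequence-++ x z
          | map-++ (conj [ c ]) (reflectionSequence x) (map (conj x) (reflectionSequence z))
    = cong (λ l → [ c ] ∷ (map (conj [ c ]) (reflectionSequence x) ++ l))
           (trans (sym (map-∘ (reflectionSequence z))) (map-cong (conj-∷ c x) (reflectionSequence z)))

  parity-reflectionSequence-++ : ∀ t x z →
    parity t (reflectionSequence (x ++ z)) ≡
    parity t (reflectionSequence x) xor parity (unconj x t) (reflectionSequence z)
  parity-reflectionSequence-++ t x z
    rewrite reflectionSequence-++ x z
          | parity-++ t (reflectionSequence x) (map (conj x) (reflectionSequence z))
          | parity-map-conj t x (reflectionSequence z)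
    = refl

  parity-ss : ∀ s y t → parity t (reflectionSequence (s ∷ s ∷ y)) ≡ parity t (reflectionSequence y)
  parity-ss s y t
    rewrite parity-reflectionSequence-++ t (s ∷ s ∷ []) y
          | xor-identityʳ (does (t ≈? (s ∷ s ∷ s ∷ [])))
          | ≈?-resp {t} {t} {s ∷ s ∷ s ∷ []} {[ s ]} ≈-refl (ss≈ε s [ s ])
          | xor-same (does (t ≈? [ s ]))
    = parity-resp-≈ (reflectionSequence y) (≈-trans (ss≈ε s _) (++-identityʳ-≈ (ss≈ε s [])))

  parity-commute : ∀ i j y t → Commute i j →
    parity t (reflectionSequence (i ∷ j ∷ y)) ≡ parity t (reflectionSequence (j ∷ i ∷ y))
  parity-commute i j y t ij
    rewrite parity-reflectionSequence-++ t (i ∷ j ∷ []) y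
          | parity-reflectionSequence-++ t (j ∷ i ∷ []) y
          | ≈?-resp {t} {t} {i ∷ j ∷ i ∷ []} {[ j ]} ≈-refl (aba≈b ij)
          | ≈?-resp {t} {t} {j ∷ i ∷ j ∷ []} {[ i ]} ≈-refl (aba≈b (commute-sym ij))
          | xor-identityʳ (does (t ≈? [ i ]))
          | xor-identityʳ (does (t ≈? [ j ]))
    = cong₂ _xor_ (xor-comm (does (t ≈? [ i ])) (does (t ≈? [ j ])))
                  (parity-resp-≈ (reflectionSequence y)
                    (≈-trans (commute-≈ (t ++ i ∷ j ∷ []) (commute-sym ij))
                             (≈-∷ i (≈-∷ j (≈-++ˡ t (commute-≈ [] ij))))))

  Rel⇒parity : ∀ {x y} → Rel x y → ∀ t → parity t (reflectionSequence x) ≡ parity t (reflectionSequence y)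
  Rel⇒parity (cancel x y s) t
    rewrite parity-reflectionSequence-++ t x (s ∷ s ∷ y) | parity-reflectionSequence-++ t x y
    = cong (parity t (reflectionSequence x) xor_) (parity-ss s y (unconj x t))
  Rel⇒parity (braid x y i j k i≢j mij) t with braid-length≡2 i j k i≢j mij
  ... | refl rewrite parity-reflectionSequence-++ t x (i ∷ j ∷ y) | parity-reflectionSequence-++ t x (j ∷ i ∷ y)
    = cong (parity t (reflectionSequence x) xor_) (parity-commute i j y (unconj x t) mij)

  ≈⇒parity : ∀ {x y} → x ≈ y → ∀ t → parity t (reflectionSequence x) ≡ parity t (reflectionSequence y)
  ≈⇒parity ε              t = refl
  ≈⇒parity (fwd r ◅ rest) t = trans (Rel⇒parity r t) (≈⇒parity rest t)
  ≈⇒parity (bwd r ◅ rest) t = trans (sym (Rel⇒parity r t)) (≈⇒parity rest t)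

  map-Pointwise : ∀ {f g : Word → Word} → (∀ r → f r ≈ g r) → ∀ A → Pointwise _≈_ (map f A) (map g A)
  map-Pointwise f≈g []      = []
  map-Pointwise f≈g (r ∷ A) = f≈g r ∷ map-Pointwise f≈g A

  reflectionSequence-reverse : ∀ p →
    Pointwise _≈_ (reflectionSequence (reverse p)) (map (unconj p) (reverse (reflectionSequence p)))
  reflectionSequence-reverse []      = []
  reflectionSequence-reverse (c ∷ p) =
    subst₂ (Pointwise _≈_) (sym split-left) (sym split-right) (Pointwise.++⁺ init (last ∷ []))
    where
      Rp = reflectionSequence p
      split-left : reflectionSequence (reverse (c ∷ p)) ≡ reflectionSequence (reverse p) ++ [ conj (reverse p) [ c ] ]
      split-left rewrite unfold-reverse c p = reflectionSequence-++ (reverse p) [ c ]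
      split-right : map (unconj (c ∷ p)) (reverse (reflectionSequence (c ∷ p))) ≡
                    map (unconj (c ∷ p)) (reverse (map (conj [ c ]) Rp)) ++ [ unconj (c ∷ p) [ c ] ]
      split-right rewrite unfold-reverse [ c ] (map (conj [ c ]) Rp) = map-++ (unconj (c ∷ p)) _ [ [ c ] ]
      unconj-∷ : ∀ r → unconj p r ≈ unconj (c ∷ p) (conj [ c ] r)
      unconj-∷ r rewrite unfold-reverse c p | ++-assoc (reverse p) [ c ] ((c ∷ (r ++ [ c ])) ++ c ∷ p) =
        ≈-sym (≈-++ˡ (reverse p) (≈-trans (ss≈ε c _)
          (≈-trans (≡⇒≈ (++-assoc r [ c ] (c ∷ p))) (≈-++ˡ r (ss≈ε c p)))))
      init : Pointwise _≈_ (reflectionSequence (reverse p)) (map (unconj (c ∷ p)) (reverse (map (conj [ c ]) Rp)))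
      init = Pointwise.transitive ≈-trans (reflectionSequence-reverse p)
               (subst (Pointwise _≈_ (map (unconj p) (reverse Rp)))
                      (trans (map-∘ (reverse Rp)) (cong (map (unconj (c ∷ p))) (reverse-map (conj [ c ]) Rp)))
                      (map-Pointwise unconj-∷ (reverse Rp)))
      last : conj (reverse p) [ c ] ≈ unconj (c ∷ p) [ c ]
      last rewrite reverse-involutive p | unfold-reverse c p | ++-assoc (reverse p) [ c ] (c ∷ c ∷ p) =
        ≈-sym (≈-++ˡ (reverse p) (ss≈ε c (c ∷ p)))

  parity-self : ∀ p s → parity (p ++ s ∷ reverse p) (reflectionSequence (p ++ s ∷ reverse p)) ≡ true
  parity-self p s = begin
    parity T (reflectionSequence (p ++ s ∷ reverse p))   ≡⟨ parity-reflectionSequence-++ T p (s ∷ reverse p) ⟩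
    b xor parity (unconj p T) (reflectionSequence (s ∷ reverse p))
      ≡⟨ cong₂ (λ x y → b xor (x xor y)) (dec-true (unconj p T ≈? [ s ]) T′≈s)
               (parity-map-conj (unconj p T) [ s ] (reflectionSequence (reverse p))) ⟩
    b xor (true xor parity (unconj [ s ] (unconj p T)) (reflectionSequence (reverse p)))
      ≡⟨ cong (λ x → b xor (true xor x)) mirror ⟩
    b xor (true xor b)                                   ≡⟨ cong (b xor_) (xor-comm true b) ⟩
    b xor (b xor true)                                   ≡⟨ sym (xor-assoc b b true) ⟩
    (b xor b) xor true                                   ≡⟨ cong (_xor true) (xor-same b) ⟩
    true                                                 ∎
    where
      open ≡-Reasoning
      T = p ++ s ∷ reverse p
      Rp = reflectionSequence p
      b = parity T Rp
      T′≈s : unconj p T ≈ [ s ]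
      T′≈s = ≈-trans (≡⇒≈ (cong (reverse p ++_) (++-assoc p (s ∷ reverse p) p)))
               (≈-trans (≈-++ˡ (reverse p) (≈-++ˡ p (≈-∷ s (reverse-inverseˡ p))))
                 (≈-trans (≡⇒≈ (sym (++-assoc (reverse p) p [ s ]))) (≈-++ʳ [ s ] (reverse-inverseˡ p))))
      T″≈s : unconj [ s ] (unconj p T) ≈ [ s ]
      T″≈s = ≈-trans (≈-∷ s (≈-++ʳ [ s ] T′≈s)) (ss≈ε s [ s ])
      back : unconj (reverse p) (unconj [ s ] (unconj p T)) ≈ T
      back rewrite reverse-involutive p = ≈-++ˡ p (≈-++ʳ (reverse p) T″≈s)
      unconj≡conj : ∀ r → unconj p r ≈ conj (reverse p) r
      unconj≡conj r rewrite reverse-involutive p = ≈-refl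
      mirror : parity (unconj [ s ] (unconj p T)) (reflectionSequence (reverse p)) ≡ b
      mirror = begin
        parity T″ (reflectionSequence (reverse p))        ≡⟨ parity-Pointwise T″ (reflectionSequence-reverse p) ⟩
        parity T″ (map (unconj p) (reverse Rp))            ≡⟨ parity-Pointwise T″ (map-Pointwise unconj≡conj (reverse Rp)) ⟩
        parity T″ (map (conj (reverse p)) (reverse Rp))    ≡⟨ parity-map-conj T″ (reverse p) (reverse Rp) ⟩
        parity (unconj (reverse p) T″) (reverse Rp)        ≡⟨ parity-resp-≈ (reverse Rp) back ⟩
        parity T (reverse Rp)                              ≡⟨ parity-reverse T Rp ⟩
        b                                                  ∎
        where T″ = unconj [ s ] (unconj p T)

  Occurs : Word → Word → Set
  Occurs t w = ∃[ a ] ∃[ s ] ∃[ b ] (w ≡ a ++ s ∷ b) × (t ≈ (a ++ s ∷ reverse a))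

  parity⇒occurs : ∀ t w → parity t (reflectionSequence w) ≡ true → Occurs t w
  parity⇒occurs t (c ∷ w) odd = go (t ≈? [ c ])
    where
      go : Dec (t ≈ [ c ]) → Occurs t (c ∷ w)
      go (yes t≈c) = [] , c , w , refl , t≈c
      go (no t≉c) with parity⇒occurs (unconj [ c ] t) w
                         (trans (sym (parity-map-conj t [ c ] (reflectionSequence w)))
                                (trans (sym (parity-∷-≉ (map (conj [ c ]) (reflectionSequence w)) t≉c)) odd))
      ... | a , s , b , refl , t′≈ =
        c ∷ a , s , b , refl ,
        ≈-trans (≈-sym (conj-unconj [ c ] t)) (≈-trans (conj-≈ [ c ] t′≈) (≡⇒≈ (conj-∷ c a [ s ])))

  deletion : ∀ a s b → ((a ++ s ∷ reverse a) ++ (a ++ s ∷ b)) ≈ (a ++ b)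
  deletion a s b rewrite ++-assoc a (s ∷ reverse a) (a ++ s ∷ b) | sym (++-assoc (reverse a) a (s ∷ b)) =
    ≈-++ˡ a (≈-trans (≈-∷ s (≈-++ʳ (s ∷ b) (reverse-inverseˡ a))) (ss≈ε s b))

  reflection-parity-self : ∀ {t} → IsReflection t → parity t (reflectionSequence t) ≡ true
  reflection-parity-self {t} (p , s , t≈) =
    trans (≈⇒parity t≈ t)
          (trans (parity-resp-≈ (reflectionSequence (p ++ s ∷ reverse p)) t≈) (parity-self p s))

  occurs-or-lengthens : ∀ {t} → IsReflection t → ∀ w → Occurs t (normalForm w) ⊎ (ℓ w < ℓ (t ++ w))
  occurs-or-lengthens {t} t-refl w with parity t (reflectionSequence (normalForm w)) in even
  ... | true  = inj₁ (parity⇒occurs t _ even)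
  ... | false with parity⇒occurs t (normalForm (t ++ normalForm w)) odd
    where
      unconj-self : unconj t t ≈ t
      unconj-self = ≈-trans (≡⇒≈ (sym (++-assoc (reverse t) t t))) (≈-++ʳ t (reverse-inverseˡ t))
      odd : parity t (reflectionSequence (normalForm (t ++ normalForm w))) ≡ true
      odd = begin
        parity t (reflectionSequence (normalForm (t ++ normalForm w)))
          ≡⟨ ≈⇒parity (normalForm-≈ (t ++ normalForm w)) t ⟩
        parity t (reflectionSequence (t ++ normalForm w))
          ≡⟨ parity-reflectionSequence-++ t t (normalForm w) ⟩
        parity t (reflectionSequence t) xor parity (unconj t t) (reflectionSequence (normalForm w))
          ≡⟨ cong₂ _xor_ (reflection-parity-self t-refl)
                         (trans (parity-resp-≈ (reflectionSequence (normalForm w)) unconj-self) even) ⟩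
        true ∎
        where open ≡-Reasoning
  ...   | a , s , b , split , t≈ = inj₂ (begin-strict
    ℓ w                                  ≤⟨ ℓ-minimal w≈ab ⟩
    length (a ++ b)                      <⟨ n<1+n _ ⟩
    suc (length (a ++ b))                ≡⟨ sym (length-++-sucʳ a s b) ⟩
    length (a ++ s ∷ b)                  ≡⟨ cong length (sym split) ⟩
    ℓ (t ++ normalForm w)                ≡⟨ ℓ-resp-≈ (≈-++ˡ t (normalForm-≈ w)) ⟩
    ℓ (t ++ w)                           ∎)
    where
      open ≤-Reasoning
      w≈ab : (a ++ b) ≈ w
      w≈ab = ≈-trans (≈-sym (deletion a s b))
               (≈-trans (≈-++ (≈-sym t≈) (≡⇒≈ (sym split)))
                 (≈-trans (≈-++ˡ t (normalForm-≈ (t ++ normalForm w)))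
                   (≈-trans (≡⇒≈ (sym (++-assoc t t (normalForm w))))
                     (≈-trans (≈-++ʳ (normalForm w) (reflection-involutive t-refl)) (normalForm-≈ w)))))

  ℓ<-sound : ∀ {x y} → x ℓ< y → ℓ x < ℓ y
  ℓ<-sound {x} {y} (x′ , x′≈x , shorter) =
    ≤-trans (s≤s (ℓ-minimal x′≈x)) (shorter (normalForm y) (normalForm-≈ y))

  inversion⇒occurs : ∀ {u t} → TL u t → Occurs t (normalForm u)
  inversion⇒occurs {u} {t} (t-refl , tu<u) with occurs-or-lengthens t-refl u
  ... | inj₁ occurs = occurs
  ... | inj₂ u<tu   = ⊥-elim (<-asym u<tu (ℓ<-sound tu<u))

  ℓ-++ : ∀ a b → ℓ (a ++ b) ≤ ℓ a + length b
  ℓ-++ a b = subst (ℓ (a ++ b) ≤_) (length-++ (normalForm a)) (ℓ-minimal (≈-++ʳ b (normalForm-≈ a)))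

  geodesic-prefix : ∀ z q → ℓ (z ++ q) ≡ length z + length q → ℓ z ≡ length z
  geodesic-prefix z q geo =
    ≤-antisym (normalForm-length z)
              (+-cancelʳ-≤ (length q) (length z) (ℓ z) (subst (_≤ ℓ z + length q) geo (ℓ-++ z q)))

  geodesic⇒covers : ∀ q z → ℓ (z ++ q) ≡ length z + length q → Star Cover z (z ++ q)
  geodesic⇒covers []      z _   = subst (Star Cover z) (sym (++-identityʳ z)) ε
  geodesic⇒covers (c ∷ q) z geo =
    cover ◅ subst (Star Cover (z ++ [ c ])) (++-assoc z [ c ] q) (geodesic⇒covers q (z ++ [ c ]) geo′)
    where
      geo′ : ℓ ((z ++ [ c ]) ++ q) ≡ length (z ++ [ c ]) + length q
      geo′ = trans (cong ℓ (++-assoc z [ c ] q))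
               (trans geo (trans (+-suc (length z) (length q)) (cong (_+ length q) (sym (length-∷ʳ z c)))))
      cover : Cover z (z ++ [ c ])
      cover = c , ≈-refl , length z ,
              subst (HasLength z) (geodesic-prefix z (c ∷ q) geo) (hasLength-ℓ z) ,
              subst (HasLength (z ++ [ c ])) (trans (geodesic-prefix (z ++ [ c ]) q geo′) (length-∷ʳ z c))
                    (hasLength-ℓ (z ++ [ c ]))

  geodesic-prefix⇒≤R : ∀ z q {u} → (z ++ q) ≈ u → ℓ u ≡ length z + length q → z ≤R u
  geodesic-prefix⇒≤R z q zq≈u geo = z ++ q , geodesic⇒covers q z (trans (ℓ-resp-≈ zq≈u) geo) , zq≈u

  covers⇒suffix : ∀ {x z} → Star Cover x z → ∃[ q ] (z ≈ (x ++ q)) × (ℓ z ≡ ℓ x + length q)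
  covers⇒suffix {x} ε = [] , ≡⇒≈ (sym (++-identityʳ x)) , sym (+-identityʳ (ℓ x))
  covers⇒suffix {x} (_◅_ {j = y} (s , y≈xs , k , x-len , xs-len) rest) with covers⇒suffix rest
  ... | q , z≈yq , ℓz≡ =
    s ∷ q , ≈-trans z≈yq (≈-trans (≈-++ʳ q y≈xs) (≡⇒≈ (++-assoc x [ s ] q))) ,
    trans ℓz≡ (trans (cong (_+ length q) ℓy≡) (sym (+-suc (ℓ x) (length q))))
    where
      ℓy≡ : ℓ y ≡ suc (ℓ x)
      ℓy≡ = trans (ℓ-resp-≈ y≈xs) (trans (sym (hasLength⇒≡ℓ xs-len)) (cong suc (hasLength⇒≡ℓ x-len)))

  TL-monotone : ∀ {x y t} → TL x t → x ≤R y → TL y t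
  TL-monotone {x} {y} {t} (t-refl , (x′ , x′≈tx , shorter)) (z , x⋖*z , z≈y) with covers⇒suffix x⋖*z
  ... | q , z≈xq , ℓz≡ = t-refl , (x′ ++ q , x′q≈ty , bound)
    where
      x′q≈ty : (x′ ++ q) ≈ (t ++ y)
      x′q≈ty = ≈-trans (≈-++ʳ q x′≈tx)
                 (≈-trans (≡⇒≈ (++-assoc t x q)) (≈-++ˡ t (≈-trans (≈-sym z≈xq) z≈y)))
      bound : ∀ y′ → y′ ≈ y → length (x′ ++ q) < length y′
      bound y′ y′≈y rewrite length-++ x′ {q} =
        ≤-trans (+-monoˡ-≤ (length q) (shorter (normalForm x) (normalForm-≈ x)))
                (≤-trans (≤-reflexive (sym ℓz≡)) (subst (_≤ length y′) (sym (ℓ-resp-≈ z≈y)) (ℓ-minimal y′≈y)))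

  Essential : Word → Fin n → Set
  Essential []      s = ⊤
  Essential (c ∷ p) s = Any (¬Commute c) (p ++ [ s ]) × Essential p s

  record EssentialSplit (s : Fin n) (a : Word) : Set where
    field
      p δ       : Word
      factor    : (a ++ [ s ]) ≈ ((p ++ [ s ]) ++ δ)
      length≡   : length p + length δ ≡ length a
      essential : Essential p s
      conj≈     : (a ++ s ∷ reverse a) ≈ (p ++ s ∷ reverse p)

  conj-commuting : ∀ {c} V → All (Commute c) V → conj [ c ] V ≈ V
  conj-commuting {c} V cs = ≈-trans (commute-past V [ c ] cs) (++-identityʳ-≈ (ss≈ε c []))

  essentialSplit : ∀ s a → EssentialSplit s a
  essentialSplit s [] = record
    { p = [] ; δ = [] ; factor = ≡⇒≈ (sym (++-identityʳ [ s ])) ; length≡ = refl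
    ; essential = tt ; conj≈ = ≈-refl }
  essentialSplit s (c ∷ a) with essentialSplit s a
  ... | record { p = p ; δ = δ ; factor = factor ; length≡ = length≡ ; essential = ess ; conj≈ = conj≈ }
    with any? (λ x → ¬? (commute? c x)) (p ++ [ s ])
  ...   | yes blocked = record
    { p = c ∷ p ; δ = δ ; factor = ≈-∷ c factor ; length≡ = cong suc length≡
    ; essential = blocked , ess
    ; conj≈ = subst₂ _≈_ (conj-∷ c a [ s ]) (conj-∷ c p [ s ]) (conj-≈ [ c ] conj≈) }
  ...   | no ¬blocked = record
    { p = p ; δ = c ∷ δ
    ; factor = ≈-trans (≈-∷ c factor) (commute-past (p ++ [ s ]) δ c-commutes)
    ; length≡ = trans (+-suc (length p) (length δ)) (cong suc length≡)
    ; essential = ess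
    ; conj≈ = subst (_≈ (p ++ s ∷ reverse p)) (conj-∷ c a [ s ])
                (≈-trans (conj-≈ [ c ] conj≈) (conj-commuting _ (++⁺ cp (cs ∷ All-reverse⁺ p cp)))) }
    where
      c-commutes : All (Commute c) (p ++ [ s ])
      c-commutes = All.map (decidable-stable (commute? c _)) (¬Any⇒All¬ _ ¬blocked)
      cp : All (Commute c) p
      cp = ++⁻ˡ p c-commutes
      cs : Commute c s
      cs with ++⁻ʳ p c-commutes
      ... | x ∷ _ = x

  All⇒¬Any¬ : ∀ {c} (xs : Word) → All (Commute c) xs → ¬ Any (¬Commute c) xs
  All⇒¬Any¬ xs cs = All¬⇒¬Any (All.map (λ c ¬c → ¬c c) cs)

  cancels-prefix : ∀ {c} β γ → Cancels c (β ++ γ) → Any (¬Commute c) β → Cancels c β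
  cancels-prefix {c} β γ (u , β′ , eq , cu) blocked with ++-≡-++ β γ u (c ∷ β′) eq
  ... | inj₁ ([] , e₁ , _) =
    ⊥-elim (All⇒¬Any¬ β (subst (All (Commute c)) (sym (trans e₁ (++-identityʳ u))) cu) blocked)
  ... | inj₁ (g ∷ γ′ , e₁ , e₂) with ∷-injective e₂
  ...   | refl , _ = u , γ′ , e₁ , cu
  cancels-prefix {c} β γ (u , β′ , eq , cu) blocked | inj₂ (μ , e₁ , _) =
    ⊥-elim (All⇒¬Any¬ β (++⁻ˡ β (subst (All (Commute c)) e₁ cu)) blocked)

  ¬cancels-[] : ∀ {x} → ¬ Cancels x []
  ¬cancels-[] (u , β , eq , _) = []≢++∷ u _ β eq

  cancels-∷ʳ⁻ : ∀ {x c} μ → Cancels x (μ ++ [ c ]) → Cancels x μ ⊎ ((x ≡ c) × All (Commute x) μ)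
  cancels-∷ʳ⁻ {x} {c} μ (u , β , eq , cu) with ++-≡-++ μ [ c ] u (x ∷ β) eq
  ... | inj₁ ([] , e₁ , e₂) with ∷-injective e₂
  ...   | refl , _ = inj₂ (refl , subst (All (Commute x)) (sym (trans e₁ (++-identityʳ u))) cu)
  cancels-∷ʳ⁻ {x} {c} μ (u , β , eq , cu) | inj₁ (g ∷ γ , e₁ , e₂) with ∷-injective e₂
  ...   | refl , _ = inj₁ (u , γ , e₁ , cu)
  cancels-∷ʳ⁻ {x} {c} μ (u , β , eq , cu) | inj₂ ([] , e₁ , e₂) with ∷-injective e₂
  ...   | refl , _ = inj₂ (refl , subst (All (Commute x)) (trans e₁ (++-identityʳ μ)) cu)
  cancels-∷ʳ⁻ {x} {c} μ (u , β , eq , cu) | inj₂ (_ ∷ ν , e₁ , e₂) = ⊥-elim ([]≢++∷ ν x β (∷-injectiveʳ e₂))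

  reducible-∷ʳ⁻ : ∀ V c → Reducible (V ++ [ c ]) →
                  Reducible V ⊎ (∃[ α ] ∃[ w ] (V ≡ α ++ c ∷ w) × All (Commute c) w)
  reducible-∷ʳ⁻ V c (α , x , w′ , eq , h) with ++-≡-++ V [ c ] α (x ∷ w′) eq
  ... | inj₁ ([] , _ , e₂) with ∷-injective e₂
  ...   | refl , refl = ⊥-elim (¬cancels-[] h)
  reducible-∷ʳ⁻ V c (α , x , w′ , eq , h) | inj₁ (g ∷ γ , e₁ , e₂) with ∷-injective e₂
  ...   | refl , refl with cancels-∷ʳ⁻ γ h
  ...     | inj₁ h′ = inj₁ (α , x , γ , e₁ , h′)
  ...     | inj₂ (refl , cs) = inj₂ (α , γ , e₁ , cs)
  reducible-∷ʳ⁻ V c (α , x , w′ , eq , h) | inj₂ ([] , _ , e₂) with ∷-injective e₂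
  ...   | refl , refl = ⊥-elim (¬cancels-[] h)
  reducible-∷ʳ⁻ V c (α , x , w′ , eq , h) | inj₂ (_ ∷ ν , _ , e₂) = ⊥-elim ([]≢++∷ ν x w′ (∷-injectiveʳ e₂))

  cancels-reverse : ∀ {c} p s γ w → s ∷ reverse p ≡ γ ++ c ∷ w → All (Commute c) w → Cancels c (p ++ [ s ])
  cancels-reverse {c} p s γ w split cw = reverse w , reverse γ , reversed , All-reverse⁺ w cw
    where
      reversed : p ++ [ s ] ≡ reverse w ++ c ∷ reverse γ
      reversed = begin
        p ++ [ s ]                         ≡⟨ sym (reverse-∷-reverse s p) ⟩
        reverse (s ∷ reverse p)            ≡⟨ cong reverse split ⟩
        reverse (γ ++ c ∷ w)               ≡⟨ reverse-++ γ (c ∷ w) ⟩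
        reverse (c ∷ w) ++ reverse γ       ≡⟨ cong (_++ reverse γ) (unfold-reverse c w) ⟩
        (reverse w ++ [ c ]) ++ reverse γ  ≡⟨ ++-assoc (reverse w) [ c ] (reverse γ) ⟩
        reverse w ++ c ∷ reverse γ         ∎
        where open ≡-Reasoning

  essential-palindrome-reduced : ∀ p s → Essential p s → Reduced (p ++ [ s ]) → Reduced (p ++ s ∷ reverse p)
  essential-palindrome-reduced []      s _               red = red
  essential-palindrome-reduced (c ∷ p) s (blocked , ess) red reducible
    with reducible-∷⁻ (subst Reducible (sym (conj-∷ c p [ s ])) reducible)
  ... | inj₁ h = red (reducible-here (cancels-prefix (p ++ [ s ]) (reverse p ++ [ c ]) (subst (Cancels c) reassoc h) blocked))
    where
      reassoc : (p ++ s ∷ reverse p) ++ [ c ] ≡ (p ++ [ s ]) ++ (reverse p ++ [ c ])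
      reassoc rewrite ++-assoc p (s ∷ reverse p) [ c ] | ++-assoc p [ s ] (reverse p ++ [ c ]) = refl
  ... | inj₂ r with reducible-∷ʳ⁻ (p ++ s ∷ reverse p) c r
  ...   | inj₁ r′ = essential-palindrome-reduced p s ess (reduced-tail red) r′
  ...   | inj₂ (α , w , split , cw) with ++-≡-++ α (c ∷ w) p (s ∷ reverse p) (sym split)
  ...     | inj₁ (γ , _ , e₂)     = red (reducible-here (cancels-reverse p s γ w e₂ cw))
  ...     | inj₂ ([] , _ , e₂)    = red (reducible-here (cancels-reverse p s [] w (sym e₂) cw))
  ...     | inj₂ (_ ∷ μ , _ , e₂) with ∷-injective e₂
  ...       | refl , w≡ with ++⁻ʳ μ (subst (All (Commute c)) w≡ cw)
  ...         | cs ∷ c-rev-p = All⇒¬Any¬ (p ++ [ s ]) (++⁺ (All-reverse⁻ p c-rev-p) (cs ∷ [])) blocked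

  normalForm-reduced-id : ∀ q → Reduced q → normalForm q ≡ q
  normalForm-reduced-id []      _   = refl
  normalForm-reduced-id (c ∷ q) red rewrite normalForm-reduced-id q (reduced-tail red) =
    push-prepends (red ∘ reducible-here)

  reduced-≈⇒≈π : ∀ {x y} → Reduced x → Reduced y → x ≈ y → x ≈π y
  reduced-≈⇒≈π {x} {y} red-x red-y x≈y =
    subst₂ _≈π_ (normalForm-reduced-id x red-x) (normalForm-reduced-id y red-y) (≈⇒normalForm-≈π x≈y)

  π-palindrome : ∀ a b (p : Word) s →
                 π a b (p ++ s ∷ reverse p) ≡ π a b p ++ (π a b [ s ] ++ reverse (π a b p))
  π-palindrome a b p s rewrite π-++ a b p (s ∷ reverse p) | π-++ a b [ s ] (reverse p) | π-reverse a b p = refl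

  length-π-singleton : ∀ a b x → length (π a b [ x ]) ≤ 1
  length-π-singleton a b x with inPair? a b x
  ... | yes x∈ab = subst (λ l → length l ≤ 1) (sym (π-accept [] x∈ab)) ≤-refl
  ... | no x∉ab  = subst (λ l → length l ≤ 1) (sym (π-reject [] x∉ab)) z≤n

  palindrome-root-unique : ∀ p₁ s₁ p₂ s₂ →
    Reduced (p₁ ++ s₁ ∷ reverse p₁) → Reduced (p₂ ++ s₂ ∷ reverse p₂) →
    (p₁ ++ s₁ ∷ reverse p₁) ≈ (p₂ ++ s₂ ∷ reverse p₂) → (p₁ ++ [ s₁ ]) ≈ (p₂ ++ [ s₂ ])
  palindrome-root-unique p₁ s₁ p₂ s₂ red₁ red₂ t₁≈t₂ = proj₁ (≈π⇒≈ (p₁ ++ [ s₁ ]) (mk≈π halves))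
    where
      halves : ∀ a b → ¬Commute a b → π a b (p₁ ++ [ s₁ ]) ≡ π a b (p₂ ++ [ s₂ ])
      halves a b ¬ab =
        trans (π-++ a b p₁ [ s₁ ])
          (trans (palindrome-injective (π a b p₁) (π a b p₂) (π a b [ s₁ ]) (π a b [ s₂ ])
                    (length-π-singleton a b s₁) (length-π-singleton a b s₂)
                    (trans (sym (π-palindrome a b p₁ s₁))
                      (trans (π-≡ (reduced-≈⇒≈π red₁ red₂ t₁≈t₂) a b ¬ab) (π-palindrome a b p₂ s₂))))
                 (sym (π-++ a b p₂ [ s₂ ])))

  record InversionRoot (u t : Word) : Set where
    field
      reflection : IsReflection t
      p          : Word
      s          : Fin n
      q          : Word
      factor     : ((p ++ [ s ]) ++ q) ≈ u
      geodesic   : ℓ u ≡ length (p ++ [ s ]) + length q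
      t≈         : t ≈ (p ++ s ∷ reverse p)
      essential  : Essential p s

    root : Word
    root = p ++ [ s ]

    root-geodesic : ℓ root ≡ length root
    root-geodesic = geodesic-prefix root q (trans (ℓ-resp-≈ factor) geodesic)

    root-reduced : Reduced root
    root-reduced = geodesic⇒reduced λ y y≈root → subst (_≤ length y) root-geodesic (ℓ-minimal y≈root)

    t-reduced : Reduced (p ++ s ∷ reverse p)
    t-reduced = essential-palindrome-reduced p s essential root-reduced

    ≈root⇒≤R : ∀ {z} → z ≈ root → length z ≡ length root → z ≤R u
    ≈root⇒≤R {z} z≈root |z|≡ =
      geodesic-prefix⇒≤R z q (≈-trans (≈-++ʳ q z≈root) factor)
                             (trans geodesic (cong (_+ length q) (sym |z|≡)))

    root-inversion : TL root t
    root-inversion = reflection , (p , ≈-sym t·root≈p , bound)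
      where
        t·root≈p : (t ++ root) ≈ p
        t·root≈p = ≈-trans (≈-++ʳ root t≈)
                     (≈-trans (≡⇒≈ (++-assoc p (s ∷ reverse p) root))
                       (≈-trans (≈-++ˡ p (≈-∷ s (≈-trans (≡⇒≈ (sym (++-assoc (reverse p) p [ s ])))
                                                          (≈-++ʳ [ s ] (reverse-inverseˡ p)))))
                         (++-identityʳ-≈ (ss≈ε s []))))
        bound : ∀ y → y ≈ root → length p < length y
        bound y y≈root = subst (_≤ length y) (trans root-geodesic (length-∷ʳ p s)) (ℓ-minimal y≈root)

  inversion-root : ∀ {u t} → TL u t → InversionRoot u t
  inversion-root {u} {t} t∈TLu@(t-refl , _) with inversion⇒occurs t∈TLu
  ... | a , s , b , nf-split , t≈ = record
    { reflection = t-refl ; p = p ; s = s ; q = δ ++ b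
    ; factor = ≈-trans (≡⇒≈ (sym (++-assoc (p ++ [ s ]) δ b)))
                 (≈-trans (≈-++ʳ b (≈-sym factor))
                   (≈-trans (≡⇒≈ (++-assoc a [ s ] b)) (≈-trans (≡⇒≈ (sym nf-split)) (normalForm-≈ u))))
    ; geodesic = lengths
    ; t≈ = ≈-trans t≈ conj≈
    ; essential = essential }
    where
      open EssentialSplit (essentialSplit s a)
      open ≡-Reasoning
      lengths : ℓ u ≡ length (p ++ [ s ]) + length (δ ++ b)
      lengths = begin
        length (normalForm u)                  ≡⟨ cong length nf-split ⟩
        length (a ++ s ∷ b)                    ≡⟨ length-++-sucʳ a s b ⟩
        suc (length (a ++ b))                  ≡⟨ cong suc (length-++ a) ⟩
        suc (length a + length b)              ≡⟨ cong (λ k → suc (k + length b)) (sym length≡) ⟩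
        suc ((length p + length δ) + length b) ≡⟨ cong suc (+-assoc (length p) (length δ) (length b)) ⟩
        suc (length p + (length δ + length b)) ≡⟨ cong₂ _+_ (sym (length-∷ʳ p s)) (sym (length-++ δ)) ⟩
        length (p ++ [ s ]) + length (δ ++ b)  ∎

proposition5p1 : ∀ {n : ℕ} (M : CoxeterMatrix n) → RightAngled M →
    ∀ (u v w : Coxeter.Word M) → Coxeter.IsMeet M w u v →
    ∀ (t : Coxeter.Word M) →
      (Coxeter.TL M w t → Coxeter.TL M u t × Coxeter.TL M v t)
      × (Coxeter.TL M u t × Coxeter.TL M v t → Coxeter.TL M w t)
proposition5p1 M RA u v w (w≤u , w≤v , greatest) t =
  (λ t∈TLw → TL-monotone t∈TLw w≤u , TL-monotone t∈TLw w≤v) , common-inversion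
  where
    open Coxeter M
    open Presentation M
    open RightAngledCoxeter M RA

    common-inversion : TL u t × TL v t → TL w t
    common-inversion (t∈TLu , t∈TLv) = TL-monotone U.root-inversion (greatest U.root root≤u root≤v)
      where
        module U = InversionRoot (inversion-root t∈TLu)
        module V = InversionRoot (inversion-root t∈TLv)
        roots≈ : U.root ≈ V.root
        roots≈ = palindrome-root-unique U.p U.s V.p V.s U.t-reduced V.t-reduced (≈-trans (≈-sym U.t≈) V.t≈)
        root≤u : U.root ≤R u
        root≤u = U.≈root⇒≤R ≈-refl refl
        root≤v : U.root ≤R v
        root≤v = V.≈root⇒≤R roots≈ (trans (sym U.root-geodesic) (trans (ℓ-resp-≈ roots≈) V.root-geodesic))
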